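{- If $p_1,\dots,p_k$ are nonnegative integers with $p_1+\cdots+p_k=n(k-1)$, then $M^n_{p_1,\ldots,p_k}=\binom{n}{n-p_1;\,\cdots;\,n-p_k}$ (the multinomial coefficient, zero if some $n-p_i<0$).
   Context: $M^n_{p_1,\ldots,p_k}:=[x_1^{p_1}\cdots x_k^{p_k}]\big((1+x_1)\cdots(1+x_k)-x_1\cdots x_k\big)^n$, equivalently the number of $n$-tuples $(S_1,\dots,S_n)$ of proper subsets of $\{1,\dots,k\}$ such that exactly $p_j$ of the sets contain $j$. -}

module Defs where

open import Data.Nat using (ℕ; zero; suc; _+_; _*_; _∸_; _≤?_)
open import Data.Nat.Combinatorics using (_C_)
open import Data.Bool using (Bool; true; false; if_then_else_)
open import Data.List using (List; []; _∷_; map; concatMap; filter; length)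
open import Data.Vec using (Vec; []; _∷_; lookup; tabulate; replicate; zipWith)
import Data.Vec as Vec
import Data.Vec.Properties as VecP
import Data.Nat.Properties as ℕP
import Data.Bool.Properties as BoolP
open import Data.Fin using (Fin)
open import Data.Fin.Subset using (Subset; inside; outside; ⊤)
open import Relation.Nullary using (¬_; Dec; yes; no)
open import Relation.Nullary.Decidable using (¬?; ⌊_⌋)
open import Relation.Binary.PropositionalEquality using (_≡_; _≢_)

allSubsets : (k : ℕ) → List (Subset k)
allSubsets zero    = [] ∷ []
allSubsets (suc k) = concatMap (λ S → (inside ∷ S) ∷ (outside ∷ S) ∷ []) (allSubsets k)

Proper : {k : ℕ} → Subset k → Set
Proper S = S ≢ ⊤

proper? : {k : ℕ} (S : Subset k) → Dec (Proper S)
proper? S = ¬? (VecP.≡-dec BoolP._≟_ S ⊤)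

properSubsets : (k : ℕ) → List (Subset k)
properSubsets k = filter proper? (allSubsets k)

tuples : (k n : ℕ) → List (Vec (Subset k) n)
tuples k zero    = [] ∷ []
tuples k (suc n) = concatMap (λ S → map (S ∷_) (tuples k n)) (properSubsets k)

ind : Bool → ℕ
ind true  = 1
ind false = 0

occ : {k n : ℕ} → Vec (Subset k) n → Vec ℕ k
occ {k} []       = replicate k 0
occ     (S ∷ ts) = zipWith _+_ (Vec.map ind S) (occ ts)

-- M^n_{p₁,…,p_k}: number of n-tuples of proper subsets of {1,…,k}
-- such that exactly p_j of the sets contain j.
M : (n : ℕ) {k : ℕ} → Vec ℕ k → ℕ
M n {k} p = length (filter (λ ts → VecP.≡-dec ℕP._≟_ (occ ts) p) (tuples k n))

-- multinomial n (a₁,…,a_k) = n! / (a₁! ⋯ a_k!) if a₁+⋯+a_k = n, and 0 otherwise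
-- (computed as the product of binomials C(n,a₁) C(n-a₁,a₂) ⋯).
multinomial : ℕ → {k : ℕ} → Vec ℕ k → ℕ
multinomial zero    []       = 1
multinomial (suc n) []       = 0
multinomial n       (a ∷ as) = (n C a) * multinomial (n ∸ a) as

multinomialDiff : ℕ → {k : ℕ} → Vec ℕ k → ℕ
multinomialDiff n p =
  if Vec.foldr _ (λ b c → b Data.Bool.∧ c) true (Vec.map (λ pᵢ → ⌊ pᵢ ≤? n ⌋) p)
  then multinomial n (Vec.map (n ∸_) p)
  else 0

-- Since every proper subset of {1,…,k} has at most k − 1 elements, the constraint
-- p₁ + ⋯ + p_k = n(k − 1) forces every set of a counted tuple to be the complement
-- of a single point j. Splitting off the first set gives
-- M^{n+1}_p = Σ_j M^n_{p − 1 + e_j}, which is exactly Pascal's recursion for the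
-- multinomial coefficients (n+1 ; n+1−p₁ ; … ; n+1−p_k), the point j dropping the
-- j-th lower entry by one.
module Submission where

open import Defs
open import Data.Nat using (ℕ; zero; suc; _+_; _*_; _∸_; _≤_; _<_; _≤ᵇ_; _≤?_; s≤s)
open import Data.Nat.Properties
open import Data.Nat.Combinatorics using (_C_; nCk+nC[k+1]≡[n+1]C[k+1]; k>n⇒nCk≡0)
open import Algebra.Properties.CommutativeSemigroup +-commutativeSemigroup
  using () renaming (interchange to +-interchange; x∙yz≈y∙xz to m+[n+o]≡n+[m+o])
open import Data.Bool using (Bool; true; false; if_then_else_; _∧_)
open import Data.Maybe as Maybe using (Maybe; just; nothing; maybe′)
open import Data.Maybe.Properties using (just-injective)
open import Data.List as List using (List; []; _∷_; filter; length; concatMap)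
open import Data.List.Properties using (length-++; filter-++; filter-≐; filter-none; filter-accept; map-cong)
open import Data.Nat.ListAction renaming (sum to sumᴸ)
open import Data.List.Relation.Unary.All as All using (All)
open import Data.List.Relation.Unary.All.Properties using (all-filter; concat⁺; map⁺)
open import Data.Vec as Vec using (Vec; []; _∷_; sum; replicate; zipWith)
import Data.Vec.Properties as VecP
open import Data.Fin.Subset using (Subset; inside; outside; ⊤; ∣_∣)
open import Data.Fin.Subset.Properties using (∣p∣≤n; ∣⊤∣≡n; ∣p∣≡n⇒p≡⊤)
open import Data.Product using (_,_)
open import Function using (_∘_)
open import Level using (0ℓ)
open import Relation.Nullary using (Dec; does; yes; no)
open import Relation.Nullary.Decidable using (dec-true; ⌊_⌋; isYes≗does)
open import Relation.Unary using (Pred; Decidable)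
open import Relation.Binary.PropositionalEquality

module _ {A : Set} {P : Pred A 0ℓ} (P? : Decidable P) where

  length-filter-concatMap : ∀ {B : Set} (f : B → List A) (xs : List B) →
    length (filter P? (concatMap f xs)) ≡ sumᴸ (List.map (λ x → length (filter P? (f x))) xs)
  length-filter-concatMap f []       = refl
  length-filter-concatMap f (x ∷ xs) = begin
    length (filter P? (f x List.++ concatMap f xs))
      ≡⟨ cong length (filter-++ P? (f x) (concatMap f xs)) ⟩
    length (filter P? (f x) List.++ filter P? (concatMap f xs))
      ≡⟨ length-++ (filter P? (f x)) ⟩
    length (filter P? (f x)) + length (filter P? (concatMap f xs))
      ≡⟨ cong (length (filter P? (f x)) +_) (length-filter-concatMap f xs) ⟩
    sumᴸ (List.map (λ x → length (filter P? (f x))) (x ∷ xs)) ∎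
    where open ≡-Reasoning

  length-filter-map : ∀ {B : Set} (g : B → A) (ys : List B) →
    length (filter P? (List.map g ys)) ≡ length (filter (λ y → P? (g y)) ys)
  length-filter-map g []       = refl
  length-filter-map g (y ∷ ys) with does (P? (g y))
  ... | true  = cong suc (length-filter-map g ys)
  ... | false = length-filter-map g ys

  sum-map-filter : (f : A → ℕ) (xs : List A) →
    sumᴸ (List.map f (filter P? xs)) ≡ sumᴸ (List.map (λ x → if does (P? x) then f x else 0) xs)
  sum-map-filter f []       = refl
  sum-map-filter f (x ∷ xs) with does (P? x)
  ... | true  = cong (f x +_) (sum-map-filter f xs)
  ... | false = sum-map-filter f xs

sumSubsets : (k : ℕ) → (Subset k → ℕ) → ℕ
sumSubsets zero    h = h []
sumSubsets (suc k) h = sumSubsets k (λ S → h (inside ∷ S) + h (outside ∷ S))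

-- The sum over the k subsets with k − 1 elements, the complements of single points.
sumCoSingletons : (k : ℕ) → (Subset k → ℕ) → ℕ
sumCoSingletons zero    h = 0
sumCoSingletons (suc k) h = sumCoSingletons k (λ S → h (inside ∷ S)) + h (outside ∷ ⊤)

sum-allSubsets : ∀ {k} (h : Subset k → ℕ) → sumᴸ (List.map h (allSubsets k)) ≡ sumSubsets k h
sum-allSubsets {zero}  h = +-identityʳ (h [])
sum-allSubsets {suc k} h = trans (pairUp (allSubsets k)) (sum-allSubsets {k} _)
  where
  pairUp : (Ss : List (Subset k)) →
    sumᴸ (List.map h (concatMap (λ S → (inside ∷ S) ∷ (outside ∷ S) ∷ []) Ss))
      ≡ sumᴸ (List.map (λ S → h (inside ∷ S) + h (outside ∷ S)) Ss)
  pairUp []       = refl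
  pairUp (S ∷ Ss) = trans (sym (+-assoc (h (inside ∷ S)) _ _)) (cong (_ +_) (pairUp Ss))

sumSubsets-cong : ∀ {k} {f g : Subset k → ℕ} → (∀ S → f S ≡ g S) → sumSubsets k f ≡ sumSubsets k g
sumSubsets-cong {zero}  f≗g = f≗g []
sumSubsets-cong {suc k} f≗g = sumSubsets-cong {k} (λ S → cong₂ _+_ (f≗g _) (f≗g _))

sumSubsets-+ : ∀ {k} (f g : Subset k → ℕ) → sumSubsets k (λ S → f S + g S) ≡ sumSubsets k f + sumSubsets k g
sumSubsets-+ {zero}  f g = refl
sumSubsets-+ {suc k} f g =
  trans (sumSubsets-cong {k} (λ S → +-interchange (f (inside ∷ S)) _ _ _)) (sumSubsets-+ {k} _ _)

sumSubsets-concentrated-⊤ : ∀ {k} (h : Subset k → ℕ) →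
  (∀ S → ∣ S ∣ ≢ k → h S ≡ 0) → sumSubsets k h ≡ h ⊤
sumSubsets-concentrated-⊤ {zero}  h _      = refl
sumSubsets-concentrated-⊤ {suc k} h off⊤⇒0 = begin
  sumSubsets k (λ S → h (inside ∷ S) + h (outside ∷ S))
    ≡⟨ sumSubsets-cong {k} (λ S → cong (h (inside ∷ S) +_) (off⊤⇒0 (outside ∷ S) (<⇒≢ (s≤s (∣p∣≤n S))))) ⟩
  sumSubsets k (λ S → h (inside ∷ S) + 0)
    ≡⟨ sumSubsets-cong {k} (λ S → +-identityʳ (h (inside ∷ S))) ⟩
  sumSubsets k (λ S → h (inside ∷ S))
    ≡⟨ sumSubsets-concentrated-⊤ {k} _ (λ S ∣S∣≢k → off⊤⇒0 (inside ∷ S) (∣S∣≢k ∘ suc-injective)) ⟩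
  h ⊤ ∎
  where open ≡-Reasoning

sumSubsets-concentrated-coSingletons : ∀ {k} (h : Subset k → ℕ) →
  (∀ S → suc ∣ S ∣ ≢ k → h S ≡ 0) → sumSubsets k h ≡ sumCoSingletons k h
sumSubsets-concentrated-coSingletons {zero}  h offCo⇒0 = offCo⇒0 [] (λ ())
sumSubsets-concentrated-coSingletons {suc k} h offCo⇒0 = begin
  sumSubsets k (λ S → h (inside ∷ S) + h (outside ∷ S))
    ≡⟨ sumSubsets-+ {k} _ _ ⟩
  sumSubsets k (λ S → h (inside ∷ S)) + sumSubsets k (λ S → h (outside ∷ S))
    ≡⟨ cong₂ _+_ (sumSubsets-concentrated-coSingletons {k} _ (λ S ne → offCo⇒0 (inside ∷ S) (ne ∘ suc-injective)))
                 (sumSubsets-concentrated-⊤ {k} _ (λ S ne → offCo⇒0 (outside ∷ S) (ne ∘ suc-injective))) ⟩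
  sumCoSingletons k (λ S → h (inside ∷ S)) + h (outside ∷ ⊤) ∎
  where open ≡-Reasoning

sumCoSingletons-cong : ∀ {k} {f g : Subset k → ℕ} →
  (∀ S → suc ∣ S ∣ ≡ k → f S ≡ g S) → sumCoSingletons k f ≡ sumCoSingletons k g
sumCoSingletons-cong {zero}  f≗g = refl
sumCoSingletons-cong {suc k} f≗g =
  cong₂ _+_ (sumCoSingletons-cong {k} (λ S eq → f≗g (inside ∷ S) (cong suc eq)))
            (f≗g (outside ∷ ⊤) (cong suc (∣⊤∣≡n k)))

sumCoSingletons-zero : ∀ {k} → sumCoSingletons k (λ _ → 0) ≡ 0
sumCoSingletons-zero {zero}  = refl
sumCoSingletons-zero {suc k} = cong (_+ 0) (sumCoSingletons-zero {k})

sumCoSingletons-* : ∀ {k} c (f : Subset k → ℕ) →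
  sumCoSingletons k (λ S → c * f S) ≡ c * sumCoSingletons k f
sumCoSingletons-* {zero}  c f = sym (*-zeroʳ c)
sumCoSingletons-* {suc k} c f =
  trans (cong (_+ c * f (outside ∷ ⊤)) (sumCoSingletons-* {k} c (λ S → f (inside ∷ S))))
        (sym (*-distribˡ-+ c _ _))

infixl 6 _⊕_ _⊖_

_⊕_ : ∀ {k} → Subset k → Vec ℕ k → Vec ℕ k
S ⊕ q = zipWith _+_ (Vec.map ind S) q

_⊖_ : ∀ {k} → Vec ℕ k → Subset k → Maybe (Vec ℕ k)
[]          ⊖ []            = just []
(x ∷ p)     ⊖ (outside ∷ S) = Maybe.map (x ∷_) (p ⊖ S)
(zero ∷ p)  ⊖ (inside ∷ S)  = nothing
(suc x ∷ p) ⊖ (inside ∷ S)  = Maybe.map (x ∷_) (p ⊖ S)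

⊕-⊖ : ∀ {k} (S : Subset k) (q : Vec ℕ k) → S ⊕ q ⊖ S ≡ just q
⊕-⊖ []            []      = refl
⊕-⊖ (outside ∷ S) (x ∷ q) = cong (Maybe.map (x ∷_)) (⊕-⊖ S q)
⊕-⊖ (inside ∷ S)  (x ∷ q) = cong (Maybe.map (x ∷_)) (⊕-⊖ S q)

⊖≡just⇒⊕ : ∀ {k} (S : Subset k) {p q : Vec ℕ k} → p ⊖ S ≡ just q → S ⊕ q ≡ p
⊖≡just⇒⊕ []            {[]}        refl = refl
⊖≡just⇒⊕ (outside ∷ S) {x ∷ p}     eq   with p ⊖ S in p⊖S | eq
... | just _ | refl = cong (x ∷_) (⊖≡just⇒⊕ S p⊖S)
⊖≡just⇒⊕ (inside ∷ S)  {suc x ∷ p} eq   with p ⊖ S in p⊖S | eq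
... | just _ | refl = cong (suc x ∷_) (⊖≡just⇒⊕ S p⊖S)

sum-⊕ : ∀ {k} (S : Subset k) (q : Vec ℕ k) → sum (S ⊕ q) ≡ ∣ S ∣ + sum q
sum-⊕ []            []      = refl
sum-⊕ (outside ∷ S) (x ∷ q) = trans (cong (x +_) (sum-⊕ S q)) (m+[n+o]≡n+[m+o] x ∣ S ∣ (sum q))
sum-⊕ (inside ∷ S)  (x ∷ q) = cong suc (trans (cong (x +_) (sum-⊕ S q)) (m+[n+o]≡n+[m+o] x ∣ S ∣ (sum q)))

sum-⊕-+suc : ∀ {k} (S : Subset k) (q : Vec ℕ k) n → sum (S ⊕ q) + suc n ≡ suc ∣ S ∣ + (sum q + n)
sum-⊕-+suc S q n =
  trans (cong (_+ suc n) (sum-⊕ S q)) (trans (+-suc _ n) (cong suc (+-assoc ∣ S ∣ (sum q) n)))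

sum-replicate-0 : ∀ k → sum (replicate k 0) ≡ 0
sum-replicate-0 zero    = refl
sum-replicate-0 (suc k) = sum-replicate-0 k

sum≡0⇒replicate-0 : ∀ {k} (p : Vec ℕ k) → sum p ≡ 0 → p ≡ replicate k 0
sum≡0⇒replicate-0 []          _       = refl
sum≡0⇒replicate-0 (zero ∷ p)  sum≡0 = cong (0 ∷_) (sum≡0⇒replicate-0 p sum≡0)

proper⇒∣S∣<k : ∀ {k} (S : Subset k) → Proper S → ∣ S ∣ < k
proper⇒∣S∣<k S S≢⊤ = ≤∧≢⇒< (∣p∣≤n S) (S≢⊤ ∘ ∣p∣≡n⇒p≡⊤)

1+∣S∣≡k⇒proper : ∀ {k} (S : Subset k) → suc ∣ S ∣ ≡ k → Proper S
1+∣S∣≡k⇒proper {k} S 1+∣S∣≡k refl = 1+n≢n (trans (cong suc (sym (∣⊤∣≡n k))) 1+∣S∣≡k)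

sum-occ-bound : ∀ {k} n → All (λ ts → sum (occ ts) + n ≤ n * k) (tuples k n)
sum-occ-bound {k} zero    = ≤-reflexive (trans (+-identityʳ _) (sum-replicate-0 k)) All.∷ All.[]
sum-occ-bound {k} (suc n) =
  concat⁺ (map⁺ (All.map (λ {S} proper → map⁺ (All.map (λ {ts} → bound-∷ S proper {ts}) (sum-occ-bound n)))
                         (all-filter proper? (allSubsets k))))
  where
  bound-∷ : ∀ S → Proper S → ∀ {ts} → sum (occ ts) + n ≤ n * k → sum (occ (S ∷ ts)) + suc n ≤ suc n * k
  bound-∷ S proper {ts} bound = begin
    sum (S ⊕ occ ts) + suc n        ≡⟨ sum-⊕-+suc S (occ ts) n ⟩
    suc ∣ S ∣ + (sum (occ ts) + n)  ≤⟨ +-mono-≤ (proper⇒∣S∣<k S proper) bound ⟩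
    k + n * k                       ∎
    where open ≤-Reasoning

M-vanishes : ∀ {k} n (p : Vec ℕ k) → n * k < sum p + n → M n p ≡ 0
M-vanishes n p n*k<sum = cong length (filter-none (λ ts → VecP.≡-dec _≟_ (occ ts) p)
  (All.map (λ bound occ≡p → <⇒≱ n*k<sum (subst (λ v → sum v + n ≤ _) occ≡p bound)) (sum-occ-bound n)))

M-zero : ∀ k → M 0 (replicate k 0) ≡ 1
M-zero k =
  cong length (filter-accept (λ ts → VecP.≡-dec _≟_ (occ ts) (replicate k 0)) {x = []} {xs = []} refl)

count-⊖ : ∀ {k} n (S : Subset k) (p : Vec ℕ k) →
  length (filter (λ ts → VecP.≡-dec _≟_ (occ (S ∷ ts)) p) (tuples k n)) ≡ maybe′ (M n) 0 (p ⊖ S)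
count-⊖ {k} n S p with p ⊖ S in p⊖S
... | just q  =
  cong length (filter-≐ _ _ ((λ {ts} → occ≡p⇒occ≡q {ts}) , (λ {ts} → occ≡q⇒occ≡p {ts})) (tuples k n))
  where
  occ≡p⇒occ≡q : ∀ {ts : Vec (Subset k) n} → S ⊕ occ ts ≡ p → occ ts ≡ q
  occ≡p⇒occ≡q {ts} eq = just-injective (trans (sym (⊕-⊖ S (occ ts))) (trans (cong (_⊖ S) eq) p⊖S))
  occ≡q⇒occ≡p : ∀ {ts : Vec (Subset k) n} → occ ts ≡ q → S ⊕ occ ts ≡ p
  occ≡q⇒occ≡p eq = trans (cong (S ⊕_) eq) (⊖≡just⇒⊕ S p⊖S)
... | nothing = cong length (filter-none _ (All.universal occ≢p (tuples k n)))
  where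
  occ≢p : ∀ ts → S ⊕ occ ts ≢ p
  occ≢p ts eq with () ← trans (sym p⊖S) (trans (cong (_⊖ S) (sym eq)) (⊕-⊖ S (occ ts)))

if-does-≡0 : ∀ {P : Set} (P? : Dec P) {v : ℕ} → (P → v ≡ 0) → (if does P? then v else 0) ≡ 0
if-does-≡0 (yes p) v≡0 = v≡0 p
if-does-≡0 (no _)  _   = refl

M-startingWith : ∀ {k} n (p : Vec ℕ k) → Subset k → ℕ
M-startingWith n p S = if does (proper? S) then maybe′ (M n) 0 (p ⊖ S) else 0

M-suc : ∀ {k} n (p : Vec ℕ k) → M (suc n) p ≡ sumSubsets k (M-startingWith n p)
M-suc {k} n p = begin
  M (suc n) p
    ≡⟨ length-filter-concatMap occ≟p _ (properSubsets k) ⟩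
  sumᴸ (List.map (λ S → length (filter occ≟p (List.map (S ∷_) (tuples k n)))) (properSubsets k))
    ≡⟨ cong sumᴸ (map-cong (λ S → trans (length-filter-map occ≟p (S ∷_) (tuples k n)) (count-⊖ n S p))
                           (properSubsets k)) ⟩
  sumᴸ (List.map (λ S → maybe′ (M n) 0 (p ⊖ S)) (filter proper? (allSubsets k)))
    ≡⟨ sum-map-filter proper? _ (allSubsets k) ⟩
  sumᴸ (List.map (λ S → if does (proper? S) then maybe′ (M n) 0 (p ⊖ S) else 0) (allSubsets k))
    ≡⟨ sum-allSubsets {k} _ ⟩
  sumSubsets k (M-startingWith n p) ∎
  where
  open ≡-Reasoning
  occ≟p : (ts : Vec (Subset k) (suc n)) → Dec (occ ts ≡ p)
  occ≟p ts = VecP.≡-dec _≟_ (occ ts) p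

-- choose m n x g = C(m, n ∸ x) · g (m ∸ (n ∸ x)) if x ≤ n and 0 otherwise (choose≡if);
-- recursing on n and x makes choose m (1 + n) (1 + x) = choose m n x definitional.
choose : ℕ → ℕ → ℕ → (ℕ → ℕ) → ℕ
choose m n       zero    g = (m C n) * g (m ∸ n)
choose m zero    (suc x) g = 0
choose m (suc n) (suc x) g = choose m n x g

-- The multinomial coefficient (m ; n ∸ p₁ ; … ; n ∸ p_k), zero if some pᵢ > n; the total m
-- is separated from n because it shrinks along the recursion on p.
multinomialDiff′ : ℕ → ℕ → ∀ {k} → Vec ℕ k → ℕ
multinomialDiff′ m n []      = multinomial m []
multinomialDiff′ m n (x ∷ p) = choose m n x (λ m′ → multinomialDiff′ m′ n p)

weighted-pascal : ∀ m e (g : ℕ → ℕ) →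
  (m C suc e) * g (suc (m ∸ suc e)) + (m C e) * g (m ∸ e) ≡ (suc m C suc e) * g (m ∸ e)
weighted-pascal m e g = begin
  (m C suc e) * g (suc (m ∸ suc e)) + (m C e) * g (m ∸ e)
    ≡⟨ cong (_+ (m C e) * g (m ∸ e)) shift ⟩
  (m C suc e) * g (m ∸ e) + (m C e) * g (m ∸ e)
    ≡⟨ sym (*-distribʳ-+ (g (m ∸ e)) (m C suc e) (m C e)) ⟩
  (m C suc e + m C e) * g (m ∸ e)
    ≡⟨ cong (_* g (m ∸ e)) (trans (+-comm (m C suc e) (m C e)) (nCk+nC[k+1]≡[n+1]C[k+1] m e)) ⟩
  (suc m C suc e) * g (m ∸ e) ∎
  where
  open ≡-Reasoning
  shift : (m C suc e) * g (suc (m ∸ suc e)) ≡ (m C suc e) * g (m ∸ e)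
  shift with e <? m
  ... | yes e<m = cong (λ j → (m C suc e) * g j) (sym (+-∸-assoc 1 e<m))
  ... | no  e≮m rewrite k>n⇒nCk≡0 (s≤s (≮⇒≥ e≮m)) = refl

choose-pascal : ∀ m n x (g : ℕ → ℕ) →
  choose m n x (g ∘ suc) + choose m n (suc x) g ≡ choose (suc m) n x g
choose-pascal m zero    zero    g = +-identityʳ _
choose-pascal m (suc e) zero    g = weighted-pascal m e g
choose-pascal m zero    (suc x) g = refl
choose-pascal m (suc n) (suc x) g = choose-pascal m n x g

choose-cong : ∀ m n x {g h : ℕ → ℕ} → (∀ {m′} → m′ ≤ m → g m′ ≡ h m′) → choose m n x g ≡ choose m n x h
choose-cong m n       zero    g≗h = cong ((m C n) *_) (g≗h (m∸n≤m m n))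
choose-cong m zero    (suc x) g≗h = refl
choose-cong m (suc n) (suc x) g≗h = choose-cong m n x g≗h

choose-zero : ∀ m n x → choose m n x (λ _ → 0) ≡ 0
choose-zero m n       zero    = *-zeroʳ (m C n)
choose-zero m zero    (suc x) = refl
choose-zero m (suc n) (suc x) = choose-zero m n x

sumCoSingletons-choose : ∀ {k} m n x (f : Subset k → ℕ → ℕ) →
  sumCoSingletons k (λ S → choose m n x (f S)) ≡ choose m n x (λ m′ → sumCoSingletons k (λ S → f S m′))
sumCoSingletons-choose {k} m n       zero    f = sumCoSingletons-* {k} (m C n) (λ S → f S (m ∸ n))
sumCoSingletons-choose {k} m zero    (suc x) f = sumCoSingletons-zero {k}
sumCoSingletons-choose {k} m (suc n) (suc x) f = sumCoSingletons-choose {k} m n x f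

maybe-multinomialDiff′-∷ : ∀ m n x {k} (r : Maybe (Vec ℕ k)) →
  maybe′ (multinomialDiff′ m n) 0 (Maybe.map (x ∷_) r)
    ≡ choose m n x (λ m′ → maybe′ (multinomialDiff′ m′ n) 0 r)
maybe-multinomialDiff′-∷ m n x (just q) = refl
maybe-multinomialDiff′-∷ m n x nothing  = sym (choose-zero m n x)

multinomialDiff′-⊖⊤ : ∀ {k} m n (p : Vec ℕ k) → m ≤ n →
  maybe′ (multinomialDiff′ m n) 0 (p ⊖ ⊤) ≡ multinomialDiff′ m (suc n) p
multinomialDiff′-⊖⊤ m n []          m≤n = refl
multinomialDiff′-⊖⊤ m n (zero ∷ p)  m≤n =
  sym (cong (_* multinomialDiff′ (m ∸ suc n) (suc n) p) (k>n⇒nCk≡0 (s≤s m≤n)))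
multinomialDiff′-⊖⊤ m n (suc x ∷ p) m≤n =
  trans (maybe-multinomialDiff′-∷ m n x (p ⊖ ⊤))
        (choose-cong m n x (λ m′≤m → multinomialDiff′-⊖⊤ _ n p (≤-trans m′≤m m≤n)))

multinomialDiff′-pascal : ∀ {k} m n (p : Vec ℕ k) → m ≤ n →
  sumCoSingletons k (λ S → maybe′ (multinomialDiff′ m n) 0 (p ⊖ S)) ≡ multinomialDiff′ (suc m) (suc n) p
multinomialDiff′-pascal         m n []      m≤n = refl
multinomialDiff′-pascal {suc k} m n (x ∷ p) m≤n = begin
  sumCoSingletons k (λ S → maybe′ (multinomialDiff′ m n) 0 ((x ∷ p) ⊖ (inside ∷ S)))
    + maybe′ (multinomialDiff′ m n) 0 ((suc x ∷ p) ⊖ ⊤)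
    ≡⟨ cong₂ _+_ (omittingLaterPoint x) (multinomialDiff′-⊖⊤ m n (suc x ∷ p) m≤n) ⟩
  choose m (suc n) x (g ∘ suc) + choose m (suc n) (suc x) g
    ≡⟨ choose-pascal m (suc n) x g ⟩
  choose (suc m) (suc n) x g ∎
  where
  open ≡-Reasoning
  g : ℕ → ℕ
  g m′ = multinomialDiff′ m′ (suc n) p

  omittingLaterPoint : ∀ x → sumCoSingletons k (λ S → maybe′ (multinomialDiff′ m n) 0 ((x ∷ p) ⊖ (inside ∷ S)))
                   ≡ choose m (suc n) x (g ∘ suc)
  omittingLaterPoint zero    =
    trans (sumCoSingletons-zero {k}) (sym (cong (_* g (suc (m ∸ suc n))) (k>n⇒nCk≡0 (s≤s m≤n))))
  omittingLaterPoint (suc x) = begin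
    sumCoSingletons k (λ S → maybe′ (multinomialDiff′ m n) 0 (Maybe.map (x ∷_) (p ⊖ S)))
      ≡⟨ sumCoSingletons-cong {k} (λ S _ → maybe-multinomialDiff′-∷ m n x (p ⊖ S)) ⟩
    sumCoSingletons k (λ S → choose m n x (λ m′ → maybe′ (multinomialDiff′ m′ n) 0 (p ⊖ S)))
      ≡⟨ sumCoSingletons-choose {k} m n x _ ⟩
    choose m n x (λ m′ → sumCoSingletons k (λ S → maybe′ (multinomialDiff′ m′ n) 0 (p ⊖ S)))
      ≡⟨ choose-cong m n x (λ m′≤m → multinomialDiff′-pascal _ n p (≤-trans m′≤m m≤n)) ⟩
    choose m n x (g ∘ suc) ∎

1+m≤ᵇ1+n : ∀ m n → (suc m ≤ᵇ suc n) ≡ (m ≤ᵇ n)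
1+m≤ᵇ1+n zero    n = refl
1+m≤ᵇ1+n (suc m) n = refl

choose≡if : ∀ m n x (g : ℕ → ℕ) → choose m n x g ≡ (if x ≤ᵇ n then (m C (n ∸ x)) * g (m ∸ (n ∸ x)) else 0)
choose≡if m n       zero    g = refl
choose≡if m zero    (suc x) g = refl
choose≡if m (suc n) (suc x) g =
  trans (choose≡if m n x g)
        (cong (λ b → if b then (m C (n ∸ x)) * g (m ∸ (n ∸ x)) else 0) (sym (1+m≤ᵇ1+n x n)))

multinomial-∷ : ∀ m a {k} (as : Vec ℕ k) → multinomial m (a ∷ as) ≡ (m C a) * multinomial (m ∸ a) as
multinomial-∷ zero    a as = refl
multinomial-∷ (suc m) a as = refl

multinomialDiff′≡guarded-multinomial : ∀ m n {k} (p : Vec ℕ k) →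
  multinomialDiff′ m n p
    ≡ (if Vec.foldr _ _∧_ true (Vec.map (λ pᵢ → ⌊ pᵢ ≤? n ⌋) p) then multinomial m (Vec.map (n ∸_) p) else 0)
multinomialDiff′≡guarded-multinomial m n []      = refl
multinomialDiff′≡guarded-multinomial m n (x ∷ p) = begin
  choose m n x (λ m′ → multinomialDiff′ m′ n p)
    ≡⟨ choose≡if m n x _ ⟩
  (if x ≤ᵇ n then (m C d) * multinomialDiff′ (m ∸ d) n p else 0)
    ≡⟨ cong (λ v → if x ≤ᵇ n then (m C d) * v else 0) (multinomialDiff′≡guarded-multinomial (m ∸ d) n p) ⟩
  (if x ≤ᵇ n then (m C d) * (if all≤n then multinomial (m ∸ d) (Vec.map (n ∸_) p) else 0) else 0)
    ≡⟨ if-∧ (x ≤ᵇ n) all≤n ⟩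
  (if (x ≤ᵇ n) ∧ all≤n then multinomial m (d ∷ Vec.map (n ∸_) p) else 0)
    ≡⟨ cong (λ b → if b ∧ all≤n then multinomial m (d ∷ Vec.map (n ∸_) p) else 0) (isYes≗does (x ≤? n)) ⟨
  (if ⌊ x ≤? n ⌋ ∧ all≤n then multinomial m (d ∷ Vec.map (n ∸_) p) else 0) ∎
  where
  open ≡-Reasoning
  d : ℕ
  d = n ∸ x
  all≤n : Bool
  all≤n = Vec.foldr _ _∧_ true (Vec.map (λ pᵢ → ⌊ pᵢ ≤? n ⌋) p)
  if-∧ : ∀ b c →
    (if b then (m C d) * (if c then multinomial (m ∸ d) (Vec.map (n ∸_) p) else 0) else 0)
      ≡ (if b ∧ c then multinomial m (d ∷ Vec.map (n ∸_) p) else 0)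
  if-∧ false c     = refl
  if-∧ true  true  = sym (multinomial-∷ m d _)
  if-∧ true  false = *-zeroʳ (m C d)

multinomialDiff′-zeros : ∀ k → multinomialDiff′ 0 0 (replicate k 0) ≡ 1
multinomialDiff′-zeros zero    = refl
multinomialDiff′-zeros (suc k) = trans (*-identityˡ _) (multinomialDiff′-zeros k)

M≡multinomialDiff′ : ∀ {k} n (p : Vec ℕ k) → sum p + n ≡ n * k → M n p ≡ multinomialDiff′ n n p
M≡multinomialDiff′ {k} zero p sum≡0
  with refl ← sum≡0⇒replicate-0 p (trans (sym (+-identityʳ (sum p))) sum≡0)
  = trans (M-zero k) (sym (multinomialDiff′-zeros k))
M≡multinomialDiff′ {k} (suc n) p budget = begin
  M (suc n) p
    ≡⟨ M-suc n p ⟩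
  sumSubsets k (M-startingWith n p)
    ≡⟨ sumSubsets-concentrated-coSingletons (M-startingWith n p) vanishes ⟩
  sumCoSingletons k (M-startingWith n p)
    ≡⟨ sumCoSingletons-cong coSingleton ⟩
  sumCoSingletons k (λ S → maybe′ (multinomialDiff′ n n) 0 (p ⊖ S))
    ≡⟨ multinomialDiff′-pascal n n p ≤-refl ⟩
  multinomialDiff′ (suc n) (suc n) p ∎
  where
  open ≡-Reasoning
  budget-⊖ : ∀ S {q} → p ⊖ S ≡ just q → suc ∣ S ∣ + (sum q + n) ≡ k + n * k
  budget-⊖ S {q} p⊖S =
    trans (sym (sum-⊕-+suc S q n)) (trans (cong (λ v → sum v + suc n) (⊖≡just⇒⊕ S {p} p⊖S)) budget)

  vanishes : ∀ S → suc ∣ S ∣ ≢ k → M-startingWith n p S ≡ 0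
  vanishes S 1+∣S∣≢k = if-does-≡0 (proper? S) vanishes-proper
    where
    vanishes-proper : Proper S → maybe′ (M n) 0 (p ⊖ S) ≡ 0
    vanishes-proper proper with p ⊖ S in p⊖S
    ... | nothing = refl
    ... | just q  = M-vanishes n q (+-cancelˡ-< k (n * k) (sum q + n)
      (subst (_< k + (sum q + n)) (budget-⊖ S p⊖S)
             (+-monoˡ-< (sum q + n) (≤∧≢⇒< (proper⇒∣S∣<k S proper) 1+∣S∣≢k))))

  coSingleton : ∀ S → suc ∣ S ∣ ≡ k → M-startingWith n p S ≡ maybe′ (multinomialDiff′ n n) 0 (p ⊖ S)
  coSingleton S 1+∣S∣≡k =
    trans (cong (λ b → if b then maybe′ (M n) 0 (p ⊖ S) else 0)
                (dec-true (proper? S) (1+∣S∣≡k⇒proper S 1+∣S∣≡k)))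
          byInduction
    where
    byInduction : maybe′ (M n) 0 (p ⊖ S) ≡ maybe′ (multinomialDiff′ n n) 0 (p ⊖ S)
    byInduction with p ⊖ S in p⊖S
    ... | nothing = refl
    ... | just q  = M≡multinomialDiff′ n q
      (+-cancelˡ-≡ k (sum q + n) (n * k) (trans (cong (_+ (sum q + n)) (sym 1+∣S∣≡k)) (budget-⊖ S p⊖S)))

proposition2p2 : (k n : ℕ) (p : Vec ℕ k) → sum p + n ≡ n * k →
    M n p ≡ multinomialDiff n p
proposition2p2 k n p budget =
  trans (M≡multinomialDiff′ n p budget) (multinomialDiff′≡guarded-multinomial n n p)
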